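{- Let $q=(f,g)$ be a state of a $9\times 9$ Sudoku grid. Then for any two cells $(i,j)$ and $(i',j')$ lying in a common group, $f(i,j)=f(i',j')$ implies $(i,j)=(i',j')$ or $f(i,j)=0$.
   Context: Cells of the $9\times 9$ grid are pairs $(i,j)$ with $0\le i,j\le 8$. A group is a row, a column, or one of the nine $3\times 3$ blocks (identified with its set of $9$ cells). A state of grid is a pair $(f,g)$ where $f$ maps each cell to a digit in $\{0,1,\dots,9\}$ ($f(i,j)=n\neq 0$ means $n$ is placed in $(i,j)$; $f(i,j)=0$ means no digit is placed) and $g$ maps each cell to a subset of $\{1,\dots,9\}$ (the set of candidates at that cell), such that for all cells $(i,j)$ and all $n\in\{1,\dots,9\}$: (S1) $g(i,j)\neq\emptyset$; (S2) $n\notin g(i,j)$ whenever either there is a nonzero digit $n'\neq n$ with $f(i,j)=n'$, or there is a cell $(i',j')\neq(i,j)$ lying in a common group with $(i,j)$ such that $f(i',j')=n$. -}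

module Defs where

open import Data.Nat using (ℕ; _/_)
open import Data.Fin using (Fin; toℕ; zero; suc)
open import Data.Fin.Subset using (Subset; _∈_; _∉_; Nonempty)
open import Data.Product using (_×_; _,_; ∃; Σ)
open import Data.Sum using (_⊎_)
open import Relation.Binary.PropositionalEquality using (_≡_; _≢_)

Cell : Set
Cell = Fin 9 × Fin 9

-- Digits 0..9 (0 = no digit placed).
Digit : Set
Digit = Fin 10

-- Candidate digits n ∈ {1,…,9} are encoded by k : Fin 9 with n = k + 1;
-- a subset of {1,…,9} is thus a Subset 9.
digitOf : Fin 9 → Digit
digitOf k = suc k

-- The 27 groups: 9 rows, 9 columns, 9 blocks (block (a , b) covers
-- rows 3a..3a+2 and columns 3b..3b+2).
data Group : Set where
  row   : Fin 9 → Group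
  col   : Fin 9 → Group
  block : Fin 3 → Fin 3 → Group

_∈G_ : Cell → Group → Set
(i , j) ∈G row r     = i ≡ r
(i , j) ∈G col c     = j ≡ c
(i , j) ∈G block a b = (toℕ i / 3 ≡ toℕ a) × (toℕ j / 3 ≡ toℕ b)

CommonGroup : Cell → Cell → Set
CommonGroup c c' = ∃ λ (G : Group) → (c ∈G G) × (c' ∈G G)

record IsState (f : Cell → Digit) (g : Cell → Subset 9) : Set where
  field
    S1 : ∀ (c : Cell) → Nonempty (g c)
    S2-placed : ∀ (c : Cell) (n n' : Fin 9) →
      f c ≡ digitOf n' → n' ≢ n → n ∉ g c
    S2-group : ∀ (c c' : Cell) (n : Fin 9) →
      c' ≢ c → CommonGroup c c' → f c' ≡ digitOf n → n ∉ g c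

-- A cell holding a digit n has n as its only possible candidate (S2, placed case),
-- while a second copy of n in a common group removes n from its candidates
-- (S2, group case); so its candidate set would be empty, contradicting S1.
module Submission where

open import Defs
open import Data.Empty using (⊥; ⊥-elim)
open import Data.Fin using (zero; suc; _≟_)
open import Data.Fin.Subset using (Subset; _∈_)
open import Data.Product using (_,_)
open import Data.Product.Properties using (≡-dec)
open import Data.Sum using (_⊎_; inj₁; inj₂)
open import Relation.Nullary using (yes; no)
open import Relation.Binary.PropositionalEquality using (_≡_; _≢_; refl; sym)

module _ {f : Cell → Digit} {g : Cell → Subset 9} (state : IsState f g) where
  open IsState state

  candidate-of-placed : ∀ {c n m} → f c ≡ digitOf n → m ∈ g c → m ≡ n
  candidate-of-placed {c} {n} {m} fc≡n m∈gc with m ≟ n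
  ... | yes m≡n = m≡n
  ... | no m≢n = ⊥-elim (S2-placed c m n fc≡n (λ n≡m → m≢n (sym n≡m)) m∈gc)

  placed-digit-unrepeated : ∀ {c c' n} → c ≢ c' → CommonGroup c c' →
    f c ≡ digitOf n → f c' ≡ digitOf n → ⊥
  placed-digit-unrepeated {c} {c'} {n} c≢c' common fc≡n fc'≡n with S1 c
  ... | m , m∈gc with candidate-of-placed fc≡n m∈gc
  ... | refl = S2-group c c' m (λ c'≡c → c≢c' (sym c'≡c)) common fc'≡n m∈gc

mainTheorem1 : (f : Cell → Digit) (g : Cell → Subset 9) → IsState f g →
    ∀ (c c' : Cell) → CommonGroup c c' → f c ≡ f c' → (c ≡ c') ⊎ (f c ≡ zero)
mainTheorem1 f g state c c' common fc≡fc' with ≡-dec _≟_ _≟_ c c' | f c in fc≡d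
... | yes c≡c' | _     = inj₁ c≡c'
... | no _     | zero  = inj₂ refl
... | no c≢c'  | suc n =
  ⊥-elim (placed-digit-unrepeated state c≢c' common fc≡d (sym fc≡fc'))
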